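{- Let $R$ be a commutative chain ring with maximal ideal $\mathfrak{m}$ satisfying $\bigcap_{\ell\ge1}\mathfrak{m}^\ell=\{0\}$, let $V$ be an $R$-module, $E$ a finite set and $A\colon E\to V$. For $S\subseteq E$ let $V_S$ be the $R$-submodule generated by $\{A(i):i\in S\}$. If $$V_{X\cap Y}\cap\mathfrak{m}V_X\cap\mathfrak{m}V_Y=\mathfrak{m}V_{X\cap Y}\quad\text{for all }X,Y\subseteq E,$$ then the rank function $r_{M[A]}$ is submodular.
   Context: A chain ring is a commutative ring whose ideals are totally ordered by inclusion (it is local). Vectors $v_1,\dots,v_\ell$ are modular independent if $\sum\alpha_iv_i=0$ implies all $\alpha_i\in\mathfrak{m}$. $M[A]$ is the independence system on $E$ whose independent sets are the $I$ with $(A(i))_{i\in I}$ modular independent; $r_{M[A]}(X)=\max\{|I|:I\subseteq X\text{ independent}\}$. Submodular means $r(X\cup Y)+r(X\cap Y)\le r(X)+r(Y)$ for all $X,Y$. -}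

module Defs where

open import Level using (Level; _⊔_; Lift) renaming (suc to lsuc)
open import Data.Nat using (ℕ; zero; suc) renaming (_+_ to _+ℕ_; _≤_ to _≤ℕ_)
open import Data.Fin using (Fin; zero; suc)
open import Data.Fin.Subset using (Subset; _∈_; _⊆_; _∩_; _∪_; ∣_∣)
open import Data.Vec using (lookup)
open import Data.Bool using (if_then_else_)
open import Data.Product using (Σ; ∃; _×_)
open import Data.Sum using (_⊎_)
open import Data.Unit using (⊤)
open import Relation.Nullary using (¬_)
open import Relation.Binary.PropositionalEquality using (_≡_)
open import Algebra.Bundles using (CommutativeRing)
open import Algebra.Module.Bundles using (Module)

module _ {c ℓ : Level} (R : CommutativeRing c ℓ) where
  open CommutativeRing R using (Carrier; _≈_; _+_; _*_; 0#; 1#)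

  RPred : Set (lsuc (c ⊔ ℓ))
  RPred = Carrier → Set (c ⊔ ℓ)

  record IsIdeal (I : RPred) : Set (c ⊔ ℓ) where
    field
      resp     : ∀ {x y} → x ≈ y → I x → I y
      0∈       : I 0#
      +-closed : ∀ {x y} → I x → I y → I (x + y)
      *-closed : ∀ r {x} → I x → I (r * x)

  _⊆ᴵ_ : RPred → RPred → Set (c ⊔ ℓ)
  I ⊆ᴵ J = ∀ x → I x → J x

  IsChainRing : Set (lsuc (c ⊔ ℓ))
  IsChainRing = ∀ I J → IsIdeal I → IsIdeal J → (I ⊆ᴵ J) ⊎ (J ⊆ᴵ I)

  IsMaximalIdeal : RPred → Set (lsuc (c ⊔ ℓ))
  IsMaximalIdeal m =
    IsIdeal m × ¬ m 1# × (∀ J → IsIdeal J → m ⊆ᴵ J → (J ⊆ᴵ m) ⊎ J 1#)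

  sumR : ∀ k → (Fin k → Carrier) → Carrier
  sumR zero    f = 0#
  sumR (suc k) f = f zero + sumR k (λ j → f (suc j))

  IdealProduct : RPred → RPred → RPred
  IdealProduct I J x =
    ∃ λ k → Σ (Fin k → Carrier) λ a → Σ (Fin k → Carrier) λ b →
      (∀ j → I (a j)) × (∀ j → J (b j)) × (x ≈ sumR k (λ j → a j * b j))

  IdealPow : RPred → ℕ → RPred
  IdealPow m zero    x = Lift (c ⊔ ℓ) ⊤
  IdealPow m (suc l) = IdealProduct m (IdealPow m l)

  PowersIntersectTrivially : RPred → Set (c ⊔ ℓ)
  PowersIntersectTrivially m =
    ∀ x → (∀ l → 1 ≤ℕ l → IdealPow m l x) → x ≈ 0#

module _ {c ℓ mv ℓv : Level} (R : CommutativeRing c ℓ) (V : Module R mv ℓv) where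
  open CommutativeRing R using (Carrier)
  open Module V using (Carrierᴹ; _≈ᴹ_; _+ᴹ_; _*ₗ_; 0ᴹ)

  sumM : ∀ k → (Fin k → Carrierᴹ) → Carrierᴹ
  sumM zero    f = 0ᴹ
  sumM (suc k) f = f zero +ᴹ sumM k (λ j → f (suc j))

  module _ {n : ℕ} (A : Fin n → Carrierᴹ) where

    combo : Subset n → (Fin n → Carrier) → Carrierᴹ
    combo S α = sumM n (λ i → if lookup S i then α i *ₗ A i else 0ᴹ)

    Span : Subset n → Carrierᴹ → Set (c ⊔ ℓv)
    Span S v = Σ (Fin n → Carrier) λ α → v ≈ᴹ combo S α

    IdealSpan : RPred R → Subset n → Carrierᴹ → Set (c ⊔ ℓ ⊔ mv ⊔ ℓv)
    IdealSpan m S v =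
      ∃ λ k → Σ (Fin k → Carrier) λ a → Σ (Fin k → Carrierᴹ) λ w →
        (∀ j → m (a j)) × (∀ j → Span S (w j)) × (v ≈ᴹ sumM k (λ j → a j *ₗ w j))

    ModularIndependent : RPred R → Subset n → Set (c ⊔ ℓ ⊔ ℓv)
    ModularIndependent m I =
      ∀ α → combo I α ≈ᴹ 0ᴹ → ∀ i → i ∈ I → m (α i)

    IsRank : RPred R → Subset n → ℕ → Set (c ⊔ ℓ ⊔ ℓv)
    IsRank m X k =
      (∃ λ I → I ⊆ X × ModularIndependent m I × ∣ I ∣ ≡ k) ×
      (∀ I → I ⊆ X → ModularIndependent m I → ∣ I ∣ ≤ℕ k)

    IntersectionCondition : RPred R → Set (c ⊔ ℓ ⊔ mv ⊔ ℓv)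
    IntersectionCondition m = ∀ X Y v →
      ((Span (X ∩ Y) v × IdealSpan m X v × IdealSpan m Y v) → IdealSpan m (X ∩ Y) v) ×
      (IdealSpan m (X ∩ Y) v → (Span (X ∩ Y) v × IdealSpan m X v × IdealSpan m Y v))

    RankSubmodular : RPred R → Set (c ⊔ ℓ ⊔ ℓv)
    RankSubmodular m = ∀ X Y a b p q →
      IsRank m (X ∪ Y) a → IsRank m (X ∩ Y) b → IsRank m X p → IsRank m Y q →
      a +ℕ b ≤ℕ p +ℕ q

-- Over a chain ring every element is a unit or lies in m, and of any two elements one
-- divides the other. Gaussian elimination, pivoting on an entry that divides its whole
-- column, therefore gives every matrix with more rows than columns a left kernel vector
-- with a unit entry; so a modular independent family inside a module generated by k
-- elements has at most k members.
--
-- Let J ⊆ X ∪ Y and I ⊆ X ∩ Y be independent of sizes r(X ∪ Y) and r(X ∩ Y), and let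
-- GX, GY, B be independent generating subsets of V_X, V_Y, V_{X∩Y}, obtained by discarding
-- redundant generators; then |GX| ≤ r(X), |GY| ≤ r(Y) and |I| ≤ |B|. If |J| + |B| exceeded
-- |GX| + |GY|, the coordinates of the A(j), j ∈ J, and of the pairs (A(b), −A(b)), b ∈ B,
-- with respect to GX ⊔ GY would satisfy a relation (λ, ν) with a unit coefficient. Its
-- J-part λ is a relation among the A(j), so λ ∈ m; then w = Σ ν_b A(b) lies in
-- V_{X∩Y} ∩ mV_X ∩ mV_Y = mV_{X∩Y}, and independence of B forces ν ∈ m as well.

{-# OPTIONS --safe #-}
module Submission where

open import Defs
open import Level using (Level; _⊔_)
open import Algebra.Bundles using (CommutativeMonoid; CommutativeRing)
open import Algebra.Module.Bundles using (Module)
open import Data.Empty using (⊥-elim)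
open import Data.Fin using (Fin; zero; suc; punchIn; _↑ˡ_; _↑ʳ_; splitAt; join)
open import Data.Fin.Properties using (join-splitAt)
open import Data.Fin.Subset using (Subset; inside; outside; _∈_; _⊆_; _∩_; _∪_; ∣_∣)
open import Data.Fin.Subset.Properties using (x∈p∪q⁻; x∈p∩q⁻)
open import Data.Nat using (ℕ; zero; suc; _<_; _≤_; _≤?_; s≤s) renaming (_+_ to _+ℕ_)
open import Data.Nat.Induction using (<-rec)
open import Data.Nat.Properties using (≤-refl; ≮⇒≥; +-monoʳ-≤; +-mono-≤; module ≤-Reasoning)
open import Data.Product using (∃; _×_; _,_; proj₁; proj₂)
open import Data.Sum using (_⊎_; inj₁; inj₂; [_,_])
open import Data.Vec using ([]; _∷_; _[_]≔_; here; there)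
open import Data.Vec.Functional using (insertAt; removeAt; _++_)
open import Data.Vec.Functional.Properties
  using (insertAt-lookup; insertAt-punchIn; removeAt-insertAt; lookup-++ˡ; lookup-++ʳ)
open import Function using (_∘_; id)
open import Relation.Binary.PropositionalEquality as ≡ using (_≡_)
open import Relation.Nullary using (¬_; yes; no; ¬¬-excluded-middle)
open import Relation.Nullary.Decidable using (decidable-stable)

elements : ∀ {n} (S : Subset n) → Fin ∣ S ∣ → Fin n
elements (inside  ∷ S) zero    = zero
elements (inside  ∷ S) (suc k) = suc (elements S k)
elements (outside ∷ S) k       = suc (elements S k)

elements-∈ : ∀ {n} (S : Subset n) k → elements S k ∈ S
elements-∈ (inside  ∷ S) zero    = here
elements-∈ (inside  ∷ S) (suc k) = there (elements-∈ S k)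
elements-∈ (outside ∷ S) k       = there (elements-∈ S k)

∈⇒∃elements : ∀ {n} {S : Subset n} {i} → i ∈ S → ∃ λ k → elements S k ≡ i
∈⇒∃elements here = zero , ≡.refl
∈⇒∃elements {S = inside  ∷ S} (there i∈S) = let k , eq = ∈⇒∃elements i∈S in suc k , ≡.cong suc eq
∈⇒∃elements {S = outside ∷ S} (there i∈S) = let k , eq = ∈⇒∃elements i∈S in k , ≡.cong suc eq

scatter : ∀ {a} {A : Set a} {n} → A → (S : Subset n) → (Fin ∣ S ∣ → A) → Fin n → A
scatter d (inside  ∷ S) β zero    = β zero
scatter d (inside  ∷ S) β (suc i) = scatter d S (β ∘ suc) i
scatter d (outside ∷ S) β zero    = d
scatter d (outside ∷ S) β (suc i) = scatter d S β i

scatter-elements : ∀ {a} {A : Set a} {n} (d : A) (S : Subset n) β k →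
                   scatter d S β (elements S k) ≡ β k
scatter-elements d (inside  ∷ S) β zero    = ≡.refl
scatter-elements d (inside  ∷ S) β (suc k) = scatter-elements d S (β ∘ suc) k
scatter-elements d (outside ∷ S) β k       = scatter-elements d S β k

-- Unlike Data.Fin.Subset._-_, removal by update computes structurally on the subset.
infixl 5 _∖_
_∖_ : ∀ {n} → Subset n → Fin n → Subset n
S ∖ i = S [ i ]≔ outside

p∖x⊆p : ∀ {n} {p : Subset n} {x} → p ∖ x ⊆ p
p∖x⊆p {p = _ ∷ p} {zero}  (there y∈p) = there y∈p
p∖x⊆p {p = _ ∷ p} {suc x} here        = here
p∖x⊆p {p = _ ∷ p} {suc x} (there y∈p) = there (p∖x⊆p y∈p)

x∈p⇒∣p∖x∣<∣p∣ : ∀ {n} {p : Subset n} {x} → x ∈ p → ∣ p ∖ x ∣ < ∣ p ∣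
x∈p⇒∣p∖x∣<∣p∣ here                          = ≤-refl
x∈p⇒∣p∖x∣<∣p∣ {p = inside  ∷ p} (there x∈p) = s≤s (x∈p⇒∣p∖x∣<∣p∣ x∈p)
x∈p⇒∣p∖x∣<∣p∣ {p = outside ∷ p} (there x∈p) = x∈p⇒∣p∖x∣<∣p∣ x∈p

module ChainRing {c ℓ : Level} (R : CommutativeRing c ℓ) where
  open CommutativeRing R hiding (zero)
  open import Algebra.Definitions.RawMagma *-rawMagma using (_∣_; _,_; module _∣ʳ_)
  open _∣ʳ_ using (quotient; equality)
  open import Algebra.Properties.Semiring.Divisibility semiring using (∣-refl; ∣-trans)
  open import Algebra.Properties.Semiring.Sum semiring
    using (sum; sum-syntax; sum-cong-≗; sum-cong-≋; sum-remove; sum-replicate-zero; ∑-distrib-+; *-distribʳ-sum)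
  open import Algebra.Properties.Ring ring using (-‿distribˡ-*)
  open import Algebra.Properties.Group +-group using (x≈y⇒x∙y⁻¹≈ε; //-rightDividesˡ; \\-leftDividesʳ)
  open import Relation.Binary.Reasoning.Setoid setoid

  ∣-isIdeal : ∀ x → IsIdeal R (x ∣_)
  ∣-isIdeal x = record
    { resp     = λ { y≈z (q , qx≈y) → q , trans qx≈y y≈z }
    ; 0∈       = 0# , zeroˡ x
    ; +-closed = λ { (q , qx≈y) (r , rx≈z) → q + r , trans (distribʳ x q r) (+-cong qx≈y rx≈z) }
    ; *-closed = λ { s (q , qx≈y) → s * q , trans (*-assoc s q x) (*-congˡ qx≈y) }
    }

  HasUnitEntry : ∀ {k} → (Fin k → Carrier) → Set (c ⊔ ℓ)
  HasUnitEntry α = ∃ λ j → α j ∣ 1#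

  module _ {r s} (C : Fin (suc r) → Fin s → Carrier) (p : Fin (suc r)) (q : Fin (suc r) → Carrier) where

    eliminate : Fin r → Fin s → Carrier
    eliminate j i = C (punchIn p j) i - q (punchIn p j) * C p i

    back-substitute : (Fin r → Carrier) → Fin (suc r) → Carrier
    back-substitute β = insertAt β p (- ∑[ j < r ] (β j * q (punchIn p j)))

    ∑-back-substitute : ∀ β i →
      ∑[ j < suc r ] (back-substitute β j * C j i) ≈ ∑[ j < r ] (β j * eliminate j i)
    ∑-back-substitute β i = begin
      ∑[ j < suc r ] (α j * C j i)
        ≈⟨ sum-remove (λ j → α j * C j i) ⟩
      α p * cₚ + ∑[ j < r ] (α (punchIn p j) * C (punchIn p j) i)
        ≡⟨ ≡.cong₂ (λ x σ → x * cₚ + σ) (insertAt-lookup β p (- t))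
                   (sum-cong-≗ λ j → ≡.cong (_* C (punchIn p j) i) (insertAt-punchIn β p (- t) j)) ⟩
      - t * cₚ + ∑[ j < r ] (β j * C (punchIn p j) i)
        ≈⟨ +-congˡ (sum-cong-≋ λ j → *-congˡ (sym (//-rightDividesˡ (q′ j * cₚ) _))) ⟩
      - t * cₚ + ∑[ j < r ] (β j * (E j + q′ j * cₚ))
        ≈⟨ +-congˡ (sum-cong-≋ λ j →
             trans (distribˡ (β j) (E j) _) (+-congˡ (sym (*-assoc (β j) (q′ j) cₚ)))) ⟩
      - t * cₚ + ∑[ j < r ] (β j * E j + β j * q′ j * cₚ)
        ≈⟨ +-congˡ (∑-distrib-+ (λ j → β j * E j) (λ j → β j * q′ j * cₚ)) ⟩
      - t * cₚ + (∑[ j < r ] (β j * E j) + ∑[ j < r ] (β j * q′ j * cₚ))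
        ≈⟨ +-congˡ (+-congˡ (sym (*-distribʳ-sum cₚ (λ j → β j * q′ j)))) ⟩
      - t * cₚ + (∑[ j < r ] (β j * E j) + t * cₚ)
        ≈⟨ +-cong (sym (-‿distribˡ-* t cₚ)) (+-comm _ (t * cₚ)) ⟩
      - (t * cₚ) + (t * cₚ + ∑[ j < r ] (β j * E j))
        ≈⟨ \\-leftDividesʳ (t * cₚ) _ ⟩
      ∑[ j < r ] (β j * E j) ∎
      where
      α : Fin (suc r) → Carrier
      α = back-substitute β
      cₚ : Carrier
      cₚ = C p i
      q′ : Fin r → Carrier
      q′ = q ∘ punchIn p
      t : Carrier
      t = ∑[ j < r ] (β j * q′ j)
      E : Fin r → Carrier
      E j = eliminate j i

  module _ (chain : IsChainRing R) where

    ∣-total : ∀ x y → (x ∣ y) ⊎ (y ∣ x)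
    ∣-total x y with chain (y ∣_) (x ∣_) (∣-isIdeal y) (∣-isIdeal x)
    ... | inj₁ y∣⊆x∣ = inj₁ (y∣⊆x∣ y ∣-refl)
    ... | inj₂ x∣⊆y∣ = inj₂ (x∣⊆y∣ x ∣-refl)

    ∣-minimum : ∀ {r} (v : Fin (suc r) → Carrier) → ∃ λ p → ∀ j → v p ∣ v j
    ∣-minimum {zero}  v = zero , λ { zero → ∣-refl }
    ∣-minimum {suc r} v with ∣-minimum (v ∘ suc)
    ... | p , vp∣ with ∣-total (v zero) (v (suc p))
    ...   | inj₁ v₀∣vp = zero , λ { zero → ∣-refl ; (suc j) → ∣-trans v₀∣vp (vp∣ j) }
    ...   | inj₂ vp∣v₀ = suc p , λ { zero → vp∣v₀ ; (suc j) → vp∣ j }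

    -- The pivot p divides its whole column, so subtracting multiples of row p clears it.
    unit-left-kernel : ∀ {r s} → s < r → (C : Fin r → Fin s → Carrier) →
                       ∃ λ α → HasUnitEntry α × ∀ i → ∑[ j < r ] (α j * C j i) ≈ 0#
    unit-left-kernel {suc r} {zero}  _         C = (λ _ → 1#) , (zero , ∣-refl) , λ ()
    unit-left-kernel {suc r} {suc s} (s≤s s<r) C with ∣-minimum (λ j → C j zero)
    ... | p , Cₚ∣ with unit-left-kernel s<r (λ j i → eliminate C p (quotient ∘ Cₚ∣) j (suc i))
    ... | β , (j₀ , βj₀∣1) , βE≈0 = back-substitute C p q β , (punchIn p j₀ , unit) , kernel
      where
      q : Fin (suc r) → Carrier
      q = quotient ∘ Cₚ∣
      unit : back-substitute C p q β (punchIn p j₀) ∣ 1#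
      unit = ≡.subst (_∣ 1#) (≡.sym (insertAt-punchIn β p _ j₀)) βj₀∣1
      kernel : ∀ i → ∑[ j < suc r ] (back-substitute C p q β j * C j i) ≈ 0#
      kernel zero    = trans (∑-back-substitute C p q β zero) (trans
        (sum-cong-≋ λ j → trans (*-congˡ (x≈y⇒x∙y⁻¹≈ε (sym (equality (Cₚ∣ (punchIn p j)))))) (zeroʳ (β j)))
        (sum-replicate-zero r))
      kernel (suc i) = trans (∑-back-substitute C p q β (suc i)) (βE≈0 i)

  module _ {m : RPred R} (maximal : IsMaximalIdeal R m) where
    open IsIdeal (proj₁ maximal) using (resp; *-closed)

    unit∉m : ∀ {x} → x ∣ 1# → ¬ m x
    unit∉m (u , ux≈1) mx = proj₁ (proj₂ maximal) (resp ux≈1 (*-closed u mx))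

    ∈m⊎unit : IsChainRing R → ∀ x → m x ⊎ (x ∣ 1#)
    ∈m⊎unit chain x with chain (x ∣_) m (∣-isIdeal x) (proj₁ maximal)
    ... | inj₁ x∣⊆m = inj₁ (x∣⊆m x ∣-refl)
    ... | inj₂ m⊆x∣ with proj₂ (proj₂ maximal) (x ∣_) (∣-isIdeal x) m⊆x∣
    ...   | inj₁ x∣⊆m = inj₁ (x∣⊆m x ∣-refl)
    ...   | inj₂ x∣1  = inj₂ x∣1

module LinearCombination {c ℓ mv ℓv : Level} {R : CommutativeRing c ℓ} (M : Module R mv ℓv) where
  open CommutativeRing R hiding (zero)
  open Module M
  open import Algebra.Properties.Semiring.Sum semiring using (sum; sum-syntax)
  open import Algebra.Properties.CommutativeMonoid.Sum +ᴹ-commutativeMonoid as ∑ᴹ using ()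
  open import Algebra.Module.Properties M using (inverseˡ-uniqueᴹ)
  open import Relation.Binary.Reasoning.Setoid ≈ᴹ-setoid

  lincomb : ∀ {k} → (Fin k → Carrier) → (Fin k → Carrierᴹ) → Carrierᴹ
  lincomb α u = ∑ᴹ.sum (λ i → α i *ₗ u i)

  *ₗ-distribˡ-sum : ∀ {k} x (v : Fin k → Carrierᴹ) → x *ₗ ∑ᴹ.sum v ≈ᴹ ∑ᴹ.sum (λ i → x *ₗ v i)
  *ₗ-distribˡ-sum {zero}  x v = *ₗ-zeroʳ x
  *ₗ-distribˡ-sum {suc k} x v =
    ≈ᴹ-trans (*ₗ-distribˡ x (v zero) _) (+ᴹ-congˡ (*ₗ-distribˡ-sum x (v ∘ suc)))

  *ₗ-distribʳ-sum : ∀ {k} (α : Fin k → Carrier) v → sum α *ₗ v ≈ᴹ ∑ᴹ.sum (λ i → α i *ₗ v)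
  *ₗ-distribʳ-sum {zero}  α v = *ₗ-zeroˡ v
  *ₗ-distribʳ-sum {suc k} α v =
    ≈ᴹ-trans (*ₗ-distribʳ v (α zero) _) (+ᴹ-congˡ (*ₗ-distribʳ-sum (α ∘ suc) v))

  module _ {k : ℕ} where

    lincomb-cong : ∀ {α β : Fin k → Carrier} {u v} → (∀ i → α i ≈ β i) → (∀ i → u i ≈ᴹ v i) →
                   lincomb α u ≈ᴹ lincomb β v
    lincomb-cong α≈β u≈v = ∑ᴹ.sum-cong-≋ {k} λ i → *ₗ-cong (α≈β i) (u≈v i)

    lincomb-zeroˡ : ∀ {α : Fin k → Carrier} u → (∀ i → α i ≈ 0#) → lincomb α u ≈ᴹ 0ᴹ
    lincomb-zeroˡ u α≈0 = ≈ᴹ-trans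
      (∑ᴹ.sum-cong-≋ {k} λ i → ≈ᴹ-trans (*ₗ-congʳ (α≈0 i)) (*ₗ-zeroˡ (u i)))
      (∑ᴹ.sum-replicate-zero k)

    lincomb-zeroʳ : ∀ α {u : Fin k → Carrierᴹ} → (∀ i → u i ≈ᴹ 0ᴹ) → lincomb α u ≈ᴹ 0ᴹ
    lincomb-zeroʳ α u≈0 = ≈ᴹ-trans
      (∑ᴹ.sum-cong-≋ {k} λ i → ≈ᴹ-trans (*ₗ-congˡ (u≈0 i)) (*ₗ-zeroʳ (α i)))
      (∑ᴹ.sum-replicate-zero k)

    lincomb-+ : ∀ (α β : Fin k → Carrier) u → lincomb (λ i → α i + β i) u ≈ᴹ lincomb α u +ᴹ lincomb β u
    lincomb-+ α β u = ≈ᴹ-trans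
      (∑ᴹ.sum-cong-≋ {k} λ i → *ₗ-distribʳ (u i) (α i) (β i))
      (∑ᴹ.∑-distrib-+ {k} _ _)

    lincomb-+ᴹ : ∀ α (u v : Fin k → Carrierᴹ) → lincomb α (λ i → u i +ᴹ v i) ≈ᴹ lincomb α u +ᴹ lincomb α v
    lincomb-+ᴹ α u v = ≈ᴹ-trans
      (∑ᴹ.sum-cong-≋ {k} λ i → *ₗ-distribˡ (α i) (u i) (v i))
      (∑ᴹ.∑-distrib-+ {k} _ _)

    lincomb-‿ : ∀ (α : Fin k → Carrier) u → lincomb (λ i → - α i) u ≈ᴹ -ᴹ lincomb α u
    lincomb-‿ α u = inverseˡ-uniqueᴹ _ _ (begin
      lincomb (λ i → - α i) u +ᴹ lincomb α u ≈⟨ lincomb-+ (λ i → - α i) α u ⟨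
      lincomb (λ i → - α i + α i) u          ≈⟨ lincomb-zeroˡ u (λ i → -‿inverseˡ (α i)) ⟩
      0ᴹ                                     ∎)

    lincomb-*ₗ : ∀ x (α : Fin k → Carrier) u → x *ₗ lincomb α u ≈ᴹ lincomb (λ i → x * α i) u
    lincomb-*ₗ x α u = ≈ᴹ-trans
      (*ₗ-distribˡ-sum {k} x _)
      (∑ᴹ.sum-cong-≋ {k} λ i → ≈ᴹ-sym (*ₗ-assoc x (α i) (u i)))

  lincomb-↑ : ∀ {a b} (α : Fin (a +ℕ b) → Carrier) u →
              lincomb α u ≈ᴹ lincomb (α ∘ (_↑ˡ b)) (u ∘ (_↑ˡ b)) +ᴹ lincomb (α ∘ (a ↑ʳ_)) (u ∘ (a ↑ʳ_))
  lincomb-↑ {zero}      α u = ≈ᴹ-sym (+ᴹ-identityˡ _)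
  lincomb-↑ {suc a} {b} α u =
    ≈ᴹ-trans (+ᴹ-congˡ (lincomb-↑ {a} {b} (α ∘ suc) (u ∘ suc))) (≈ᴹ-sym (+ᴹ-assoc _ _ _))

  lincomb-++ : ∀ {a b} (α : Fin a → Carrier) (β : Fin b → Carrier) g h →
               lincomb (α ++ β) (g ++ h) ≈ᴹ lincomb α g +ᴹ lincomb β h
  lincomb-++ {a} {b} α β g h = ≈ᴹ-trans (lincomb-↑ {a} {b} (α ++ β) (g ++ h)) (+ᴹ-cong
    (lincomb-cong (reflexive ∘ lookup-++ˡ α β) (≈ᴹ-reflexive ∘ lookup-++ˡ g h))
    (lincomb-cong (reflexive ∘ lookup-++ʳ α β) (≈ᴹ-reflexive ∘ lookup-++ʳ g h)))

  lincomb-lincomb : ∀ {r s} (α : Fin r → Carrier) (C : Fin r → Fin s → Carrier) g →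
                    lincomb α (λ j → lincomb (C j) g) ≈ᴹ lincomb (λ i → ∑[ j < r ] (α j * C j i)) g
  lincomb-lincomb {r} {s} α C g = begin
    ∑ᴹ.sum (λ j → α j *ₗ ∑ᴹ.sum (λ i → C j i *ₗ g i))
      ≈⟨ ∑ᴹ.sum-cong-≋ {r} (λ j → *ₗ-distribˡ-sum {s} (α j) _) ⟩
    ∑ᴹ.sum (λ j → ∑ᴹ.sum (λ i → α j *ₗ (C j i *ₗ g i)))
      ≈⟨ ∑ᴹ.sum-cong-≋ {r} (λ j → ∑ᴹ.sum-cong-≋ {s} λ i → ≈ᴹ-sym (*ₗ-assoc (α j) (C j i) (g i))) ⟩
    ∑ᴹ.sum (λ j → ∑ᴹ.sum (λ i → (α j * C j i) *ₗ g i))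
      ≈⟨ ∑ᴹ.∑-comm (λ j i → (α j * C j i) *ₗ g i) ⟩
    ∑ᴹ.sum (λ i → ∑ᴹ.sum (λ j → (α j * C j i) *ₗ g i))
      ≈⟨ ∑ᴹ.sum-cong-≋ {s} (λ i → ≈ᴹ-sym (*ₗ-distribʳ-sum (λ j → α j * C j i) (g i))) ⟩
    ∑ᴹ.sum (λ i → (∑[ j < r ] (α j * C j i)) *ₗ g i)
      ∎

  infix 4 _∈span_
  _∈span_ : ∀ {k} → Carrierᴹ → (Fin k → Carrierᴹ) → Set (c ⊔ ℓv)
  v ∈span g = ∃ λ α → v ≈ᴹ lincomb α g

  module _ {k : ℕ} {g : Fin k → Carrierᴹ} where

    ∈span-resp : ∀ {v w} → v ≈ᴹ w → w ∈span g → v ∈span g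
    ∈span-resp v≈w (α , w≈αg) = α , ≈ᴹ-trans v≈w w≈αg

    ∈span-+ᴹ : ∀ {v w} → v ∈span g → w ∈span g → v +ᴹ w ∈span g
    ∈span-+ᴹ (α , v≈αg) (β , w≈βg) =
      (λ i → α i + β i) , ≈ᴹ-trans (+ᴹ-cong v≈αg w≈βg) (≈ᴹ-sym (lincomb-+ α β g))

    ∈span-*ₗ : ∀ x {v} → v ∈span g → x *ₗ v ∈span g
    ∈span-*ₗ x (α , v≈αg) = (λ i → x * α i) , ≈ᴹ-trans (*ₗ-congˡ v≈αg) (lincomb-*ₗ x α g)

    ∈span-‿ : ∀ {v} → v ∈span g → -ᴹ v ∈span g
    ∈span-‿ (α , v≈αg) = (λ i → - α i) , ≈ᴹ-trans (-ᴹ‿cong v≈αg) (≈ᴹ-sym (lincomb-‿ α g))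

  lincomb-∈span : ∀ {r s} {u : Fin r → Carrierᴹ} {g : Fin s → Carrierᴹ} →
                  (∀ j → u j ∈span g) → ∀ α → lincomb α u ∈span g
  lincomb-∈span u∈ α = (λ i → ∑[ j < _ ] (α j * proj₁ (u∈ j) i)) ,
    ≈ᴹ-trans (lincomb-cong (λ _ → refl) (proj₂ ∘ u∈)) (lincomb-lincomb α (proj₁ ∘ u∈) _)

  generator-∈span : ∀ {k} (g : Fin k → Carrierᴹ) i → g i ∈span g
  generator-∈span {suc k} g i = e , ≈ᴹ-sym (begin
    ∑ᴹ.sum (λ j → e j *ₗ g j)
      ≈⟨ ∑ᴹ.sum-remove {i = i} (λ j → e j *ₗ g j) ⟩
    e i *ₗ g i +ᴹ lincomb (removeAt e i) (removeAt g i)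
      ≈⟨ +ᴹ-cong (*ₗ-congʳ (reflexive (insertAt-lookup _ i 1#)))
                 (lincomb-zeroˡ _ (reflexive ∘ removeAt-insertAt _ i 1#)) ⟩
    1# *ₗ g i +ᴹ 0ᴹ
      ≈⟨ +ᴹ-identityʳ _ ⟩
    1# *ₗ g i
      ≈⟨ *ₗ-identityˡ (g i) ⟩
    g i
      ∎)
    where
    e : Fin (suc k) → Carrier
    e = insertAt (λ _ → 0#) i 1#

  module _ {a b} {g : Fin a → Carrierᴹ} {h : Fin b → Carrierᴹ} where

    ∈span-++ˡ : ∀ {v} → v ∈span g → v ∈span (g ++ h)
    ∈span-++ˡ (α , v≈αg) = α ++ (λ _ → 0#) , ≈ᴹ-trans v≈αg (≈ᴹ-sym (≈ᴹ-trans (lincomb-++ α _ g h)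
      (≈ᴹ-trans (+ᴹ-congˡ (lincomb-zeroˡ h λ _ → refl)) (+ᴹ-identityʳ _))))

    ∈span-++ʳ : ∀ {v} → v ∈span h → v ∈span (g ++ h)
    ∈span-++ʳ (β , v≈βh) = (λ _ → 0#) ++ β , ≈ᴹ-trans v≈βh (≈ᴹ-sym (≈ᴹ-trans (lincomb-++ _ β g h)
      (≈ᴹ-trans (+ᴹ-congʳ (lincomb-zeroˡ g λ _ → refl)) (+ᴹ-identityˡ _))))

module Independence {c ℓ mv ℓv : Level} {R : CommutativeRing c ℓ} {m : RPred R}
                    (chain : IsChainRing R) (maximal : IsMaximalIdeal R m) (M : Module R mv ℓv) where
  open CommutativeRing R hiding (zero)
  open Module M
  open ChainRing R
  open LinearCombination M
  open IsIdeal (proj₁ maximal)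
    renaming (resp to m-resp; 0∈ to 0∈m; +-closed to m-+-closed; *-closed to m-*-closed)
  open import Algebra.Properties.Semiring.Sum semiring using (sum; sum-syntax)
  open import Algebra.Properties.Ring ring using (-1*x≈-x)
  open import Algebra.Properties.Group +-group using (//-rightDividesˡ)
  open import Algebra.Module.Properties M using (inverseʳ-uniqueᴹ)
  open import Relation.Binary.Reasoning.Setoid ≈ᴹ-setoid

  m-‿-closed : ∀ {x} → m x → m (- x)
  m-‿-closed mx = m-resp (-1*x≈-x _) (m-*-closed (- 1#) mx)

  m-sum-closed : ∀ {k} {f : Fin k → Carrier} → (∀ i → m (f i)) → m (sum f)
  m-sum-closed {zero}  _  = 0∈m
  m-sum-closed {suc k} mf = m-+-closed (mf zero) (m-sum-closed (mf ∘ suc))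

  Independent : ∀ {k} → (Fin k → Carrierᴹ) → Set (c ⊔ ℓ ⊔ ℓv)
  Independent u = ∀ α → lincomb α u ≈ᴹ 0ᴹ → ∀ i → m (α i)

  infix 4 _∈m-span_
  _∈m-span_ : ∀ {k} → Carrierᴹ → (Fin k → Carrierᴹ) → Set (c ⊔ ℓ ⊔ ℓv)
  v ∈m-span g = ∃ λ κ → (∀ i → m (κ i)) × v ≈ᴹ lincomb κ g

  ∈m-span-resp : ∀ {k} {g : Fin k → Carrierᴹ} {v w} → v ≈ᴹ w → w ∈m-span g → v ∈m-span g
  ∈m-span-resp v≈w (κ , κ∈m , w≈κg) = κ , κ∈m , ≈ᴹ-trans v≈w w≈κg

  lincomb-∈m-span : ∀ {r s} {α : Fin r → Carrier} {u} {g : Fin s → Carrierᴹ} →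
                    (∀ j → m (α j)) → (∀ j → u j ∈span g) → lincomb α u ∈m-span g
  lincomb-∈m-span {α = α} α∈m u∈ =
    _ , (λ i → m-sum-closed λ j → m-resp (*-comm _ _) (m-*-closed _ (α∈m j))) , proj₂ (lincomb-∈span u∈ α)

  unit-relation⇒¬independent : ∀ {k} {u : Fin k → Carrierᴹ} {α} →
                               HasUnitEntry α → lincomb α u ≈ᴹ 0ᴹ → ¬ Independent u
  unit-relation⇒¬independent (j , αj∣1) αu≈0 independent = unit∉m maximal αj∣1 (independent _ αu≈0 j)

  unit-relation : ∀ {r s} {u : Fin r → Carrierᴹ} {g : Fin s → Carrierᴹ} → s < r → (∀ j → u j ∈span g) →
                  ∃ λ α → HasUnitEntry α × lincomb α u ≈ᴹ 0ᴹ
  unit-relation {u = u} {g} s<r u∈ with unit-left-kernel chain s<r (proj₁ ∘ u∈)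
  ... | α , unit , kernel = α , unit , (begin
    lincomb α u                                         ≈⟨ lincomb-cong (λ _ → refl) (proj₂ ∘ u∈) ⟩
    lincomb α (λ j → lincomb (proj₁ (u∈ j)) g)          ≈⟨ lincomb-lincomb α (proj₁ ∘ u∈) g ⟩
    lincomb (λ i → ∑[ j < _ ] (α j * proj₁ (u∈ j) i)) g ≈⟨ lincomb-zeroˡ g kernel ⟩
    0ᴹ                                                  ∎)

  independent⇒length≤ : ∀ {r s} {u : Fin r → Carrierᴹ} {g : Fin s → Carrierᴹ} →
                        Independent u → (∀ j → u j ∈span g) → r ≤ s
  independent⇒length≤ independent u∈ = ≮⇒≥ λ s<r →
    let α , unit , αu≈0 = unit-relation s<r u∈ in unit-relation⇒¬independent unit αu≈0 independent

  module _ {p q a b} {gX : Fin p → Carrierᴹ} {gY : Fin q → Carrierᴹ}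
           {uJ : Fin a → Carrierᴹ} {uB : Fin b → Carrierᴹ}
           (uJ-independent : Independent uJ) (uB-independent : Independent uB)
           (uJ∈ : ∀ j → uJ j ∈span (gX ++ gY)) (uB∈X : ∀ k → uB k ∈span gX) (uB∈Y : ∀ k → uB k ∈span gY)
           (intersection : ∀ {w} → w ∈span uB → w ∈m-span gX → w ∈m-span gY → w ∈m-span uB) where

    -- The rows of C are the coordinates of uJ j and of (uB k, -ᴹ uB k) with respect to gX ++ gY.
    cJ : Fin a → Fin (p +ℕ q) → Carrier
    cJ = proj₁ ∘ uJ∈

    cB : Fin b → Fin (p +ℕ q) → Carrier
    cB k = proj₁ (uB∈X k) ++ λ i → - proj₁ (uB∈Y k) i

    C : Fin (a +ℕ b) → Fin (p +ℕ q) → Carrier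
    C = cJ ++ cB

    πX πY : (Fin (p +ℕ q) → Carrier) → Carrierᴹ
    πX γ = lincomb (γ ∘ (_↑ˡ q)) gX
    πY γ = lincomb (γ ∘ (p ↑ʳ_)) gY

    π-split : ∀ γ → lincomb γ (gX ++ gY) ≈ᴹ πX γ +ᴹ πY γ
    π-split γ = ≈ᴹ-trans (lincomb-↑ {p} {q} γ (gX ++ gY)) (+ᴹ-cong
      (lincomb-cong (λ _ → refl) (≈ᴹ-reflexive ∘ lookup-++ˡ gX gY))
      (lincomb-cong (λ _ → refl) (≈ᴹ-reflexive ∘ lookup-++ʳ gX gY)))

    π-cJ : ∀ j → πX (cJ j) +ᴹ πY (cJ j) ≈ᴹ uJ j
    π-cJ j = ≈ᴹ-trans (≈ᴹ-sym (π-split (cJ j))) (≈ᴹ-sym (proj₂ (uJ∈ j)))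

    πX-cB : ∀ k → πX (cB k) ≈ᴹ uB k
    πX-cB k = ≈ᴹ-trans (lincomb-cong {p} (reflexive ∘ lookup-++ˡ _ _) (λ _ → ≈ᴹ-refl))
                       (≈ᴹ-sym (proj₂ (uB∈X k)))

    πY-cB : ∀ k → πY (cB k) ≈ᴹ -ᴹ uB k
    πY-cB k = begin
      πY (cB k)
        ≈⟨ lincomb-cong {q} (reflexive ∘ lookup-++ʳ (proj₁ (uB∈X k)) _) (λ _ → ≈ᴹ-refl) ⟩
      lincomb (λ i → - proj₁ (uB∈Y k) i) gY
        ≈⟨ lincomb-‿ _ gY ⟩
      -ᴹ lincomb (proj₁ (uB∈Y k)) gY
        ≈⟨ -ᴹ‿cong (proj₂ (uB∈Y k)) ⟨
      -ᴹ uB k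
        ∎

    π-cB : ∀ k → lincomb (cB k) (gX ++ gY) ≈ᴹ 0ᴹ
    π-cB k = ≈ᴹ-trans (π-split (cB k)) (≈ᴹ-trans (+ᴹ-cong (πX-cB k) (πY-cB k)) (-ᴹ‿inverseʳ (uB k)))

    module _ {α : Fin (a +ℕ b) → Carrier} (kernel : ∀ i → ∑[ r < a +ℕ b ] (α r * C r i) ≈ 0#) where

      λJ : Fin a → Carrier
      λJ = α ∘ (_↑ˡ b)

      νB : Fin b → Carrier
      νB = α ∘ (a ↑ʳ_)

      restricted-relation : ∀ {s} (ι : Fin s → Fin (p +ℕ q)) h →
        lincomb λJ (λ j → lincomb (cJ j ∘ ι) h) +ᴹ lincomb νB (λ k → lincomb (cB k ∘ ι) h) ≈ᴹ 0ᴹ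
      restricted-relation ι h = begin
        lincomb λJ (λ j → lincomb (cJ j ∘ ι) h) +ᴹ lincomb νB (λ k → lincomb (cB k ∘ ι) h)
          ≈⟨ +ᴹ-cong (lincomb-cong {a} (λ _ → refl) (≈ᴹ-reflexive ∘ ≡.cong ρ′ ∘ lookup-++ˡ cJ cB))
                     (lincomb-cong {b} (λ _ → refl) (≈ᴹ-reflexive ∘ ≡.cong ρ′ ∘ lookup-++ʳ cJ cB)) ⟨
        lincomb λJ (ρ ∘ (_↑ˡ b)) +ᴹ lincomb νB (ρ ∘ (a ↑ʳ_))
          ≈⟨ lincomb-↑ {a} {b} α ρ ⟨
        lincomb α ρ
          ≈⟨ lincomb-lincomb α (λ r → C r ∘ ι) h ⟩
        lincomb (λ i → ∑[ r < a +ℕ b ] (α r * C r (ι i))) h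
          ≈⟨ lincomb-zeroˡ h (kernel ∘ ι) ⟩
        0ᴹ
          ∎
        where
        ρ′ : (Fin (p +ℕ q) → Carrier) → Carrierᴹ
        ρ′ γ = lincomb (γ ∘ ι) h
        ρ : Fin (a +ℕ b) → Carrierᴹ
        ρ = ρ′ ∘ C

      λJ-relation : lincomb λJ uJ ≈ᴹ 0ᴹ
      λJ-relation = begin
        lincomb λJ uJ
          ≈⟨ lincomb-cong {a} (λ _ → refl) (proj₂ ∘ uJ∈) ⟩
        lincomb λJ (λ j → lincomb (cJ j) (gX ++ gY))
          ≈⟨ +ᴹ-identityʳ _ ⟨
        lincomb λJ (λ j → lincomb (cJ j) (gX ++ gY)) +ᴹ 0ᴹ
          ≈⟨ +ᴹ-congˡ (lincomb-zeroʳ νB π-cB) ⟨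
        lincomb λJ (λ j → lincomb (cJ j) (gX ++ gY)) +ᴹ lincomb νB (λ k → lincomb (cB k) (gX ++ gY))
          ≈⟨ restricted-relation id (gX ++ gY) ⟩
        0ᴹ
          ∎

      λJ∈m : ∀ j → m (λJ j)
      λJ∈m = uJ-independent λJ λJ-relation

      W : Carrierᴹ
      W = lincomb νB uB

      πX-relation : lincomb λJ (πX ∘ cJ) +ᴹ W ≈ᴹ 0ᴹ
      πX-relation = ≈ᴹ-trans (+ᴹ-congˡ (lincomb-cong {b} (λ _ → refl) (≈ᴹ-sym ∘ πX-cB)))
                             (restricted-relation (_↑ˡ q) gX)

      π-relation : lincomb λJ (πX ∘ cJ) +ᴹ lincomb λJ (πY ∘ cJ) ≈ᴹ 0ᴹ
      π-relation = ≈ᴹ-trans (≈ᴹ-sym (lincomb-+ᴹ λJ _ _))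
                            (≈ᴹ-trans (lincomb-cong {a} (λ _ → refl) π-cJ) λJ-relation)

      W≈-πX : W ≈ᴹ -ᴹ lincomb λJ (πX ∘ cJ)
      W≈-πX = inverseʳ-uniqueᴹ _ _ πX-relation

      W∈m-span-gX : W ∈m-span gX
      W∈m-span-gX = ∈m-span-resp (≈ᴹ-trans W≈-πX (≈ᴹ-sym (lincomb-‿ λJ _)))
                                 (lincomb-∈m-span (m-‿-closed ∘ λJ∈m) λ j → _ , ≈ᴹ-refl)

      W∈m-span-gY : W ∈m-span gY
      W∈m-span-gY = ∈m-span-resp (≈ᴹ-trans W≈-πX (≈ᴹ-sym (inverseʳ-uniqueᴹ _ _ π-relation)))
                                 (lincomb-∈m-span λJ∈m λ j → _ , ≈ᴹ-refl)

      νB∈m : ∀ k → m (νB k)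
      νB∈m k with intersection (νB , ≈ᴹ-refl) W∈m-span-gX W∈m-span-gY
      ... | μ , μ∈m , W≈μuB =
        m-resp (//-rightDividesˡ (μ k) (νB k)) (m-+-closed (uB-independent _ ν-μ-relation k) (μ∈m k))
        where
        ν-μ-relation : lincomb (λ k → νB k - μ k) uB ≈ᴹ 0ᴹ
        ν-μ-relation = begin
          lincomb (λ k → νB k - μ k) uB  ≈⟨ lincomb-+ νB (λ k → - μ k) uB ⟩
          W +ᴹ lincomb (λ k → - μ k) uB  ≈⟨ +ᴹ-congˡ (lincomb-‿ μ uB) ⟩
          W +ᴹ -ᴹ lincomb μ uB           ≈⟨ +ᴹ-congˡ (-ᴹ‿cong W≈μuB) ⟨
          W +ᴹ -ᴹ W                      ≈⟨ -ᴹ‿inverseʳ W ⟩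
          0ᴹ                             ∎

      kernel-in-m : ∀ r → m (α r)
      kernel-in-m r =
        ≡.subst (m ∘ α) (join-splitAt a b r) ([_,_] {C = m ∘ α ∘ join a b} λJ∈m νB∈m (splitAt a r))

    length-submodular : a +ℕ b ≤ p +ℕ q
    length-submodular = ≮⇒≥ λ p+q<a+b →
      let α , (r , αr∣1) , kernel = unit-left-kernel chain p+q<a+b C
      in  unit∉m maximal αr∣1 (kernel-in-m kernel r)

module Subsets {c ℓ mv ℓv : Level} {R : CommutativeRing c ℓ} {m : RPred R}
               (chain : IsChainRing R) (maximal : IsMaximalIdeal R m) (V : Module R mv ℓv) where
  open CommutativeRing R hiding (zero)
  open Module V
  open ChainRing R
  open LinearCombination V
  open Independence chain maximal V
  open import Algebra.Definitions.RawMagma *-rawMagma using (_,_)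
  open import Algebra.Properties.CommutativeMonoid.Sum +ᴹ-commutativeMonoid as ∑ᴹ using ()
  open import Algebra.Properties.CommutativeSemigroup
    (CommutativeMonoid.commutativeSemigroup +ᴹ-commutativeMonoid) using (x∙yz≈y∙xz)
  open import Algebra.Module.Properties V using (inverseˡ-uniqueᴹ)
  open import Relation.Binary.Reasoning.Setoid ≈ᴹ-setoid

  sumM≡sum : ∀ {k} (f : Fin k → Carrierᴹ) → sumM R V k f ≡ ∑ᴹ.sum f
  sumM≡sum {zero}  f = ≡.refl
  sumM≡sum {suc k} f = ≡.cong (f zero +ᴹ_) (sumM≡sum (f ∘ suc))

  combo-elements : ∀ {n} (A : Fin n → Carrierᴹ) S α →
                   combo R V A S α ≈ᴹ lincomb (α ∘ elements S) (A ∘ elements S)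
  combo-elements A []            α = ≈ᴹ-refl
  combo-elements A (inside  ∷ S) α = +ᴹ-congˡ (combo-elements (A ∘ suc) S (α ∘ suc))
  combo-elements A (outside ∷ S) α = ≈ᴹ-trans (+ᴹ-identityˡ _) (combo-elements (A ∘ suc) S (α ∘ suc))

  combo-∖ : ∀ {n} (A : Fin n → Carrierᴹ) {S i} α → i ∈ S →
            combo R V A S α ≈ᴹ α i *ₗ A i +ᴹ combo R V A (S ∖ i) α
  combo-∖ A α here        = +ᴹ-congˡ (≈ᴹ-sym (+ᴹ-identityˡ _))
  combo-∖ A α (there i∈S) = ≈ᴹ-trans (+ᴹ-congˡ (combo-∖ (A ∘ suc) (α ∘ suc) i∈S)) (x∙yz≈y∙xz _ _ _)

  module _ {n} (A : Fin n → Carrierᴹ) where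

    Generates : Subset n → Subset n → Set (c ⊔ ℓv)
    Generates Z G = ∀ {z} → z ∈ Z → Span R V A G (A z)

    IsBasis : Subset n → Subset n → Set (c ⊔ ℓ ⊔ ℓv)
    IsBasis Z G = G ⊆ Z × Generates Z G × ModularIndependent R V A m G

    Span⇒∈span : ∀ {S v} → Span R V A S v → v ∈span (A ∘ elements S)
    Span⇒∈span {S} (α , v≈αS) = α ∘ elements S , ≈ᴹ-trans v≈αS (combo-elements A S α)

    combo-scatter : ∀ S β → combo R V A S (scatter 0# S β) ≈ᴹ lincomb β (A ∘ elements S)
    combo-scatter S β = ≈ᴹ-trans (combo-elements A S _)
                                 (lincomb-cong (reflexive ∘ scatter-elements 0# S β) (λ _ → ≈ᴹ-refl))

    ∈span⇒Span : ∀ {S v} → v ∈span (A ∘ elements S) → Span R V A S v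
    ∈span⇒Span {S} (β , v≈βS) = scatter 0# S β , ≈ᴹ-trans v≈βS (≈ᴹ-sym (combo-scatter S β))

    MI⇒Independent : ∀ {S} → ModularIndependent R V A m S → Independent (A ∘ elements S)
    MI⇒Independent {S} independent β βS≈0 k = ≡.subst m (scatter-elements 0# S β k)
      (independent _ (≈ᴹ-trans (combo-scatter S β) βS≈0) (elements S k) (elements-∈ S k))

    Generates-refl : ∀ Z → Generates Z Z
    Generates-refl Z z∈Z with ∈⇒∃elements z∈Z
    ... | k , ≡.refl = ∈span⇒Span {Z} (generator-∈span (A ∘ elements Z) k)

    Generates⇒∈span : ∀ {Z G z} → Generates Z G → z ∈ Z → A z ∈span (A ∘ elements G)
    Generates⇒∈span {G = G} generates z∈Z = Span⇒∈span {G} (generates z∈Z)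

    Span-generated : ∀ {Z G v} → Generates Z G → Span R V A Z v → Span R V A G v
    Span-generated {Z} {G} generates v∈VZ = ∈span⇒Span {G} (∈span-resp (proj₂ (Span⇒∈span {Z} v∈VZ))
      (lincomb-∈span (λ k → Generates⇒∈span {G = G} generates (elements-∈ Z k)) _))

    Span-∖-redundant : ∀ {G i v} → i ∈ G → Span R V A (G ∖ i) (A i) →
                       Span R V A G v → Span R V A (G ∖ i) v
    Span-∖-redundant {G} {i} i∈G Ai∈ (α , v≈αG) = ∈span⇒Span {G ∖ i}
      (∈span-resp (≈ᴹ-trans v≈αG (combo-∖ A α i∈G))
        (∈span-+ᴹ (∈span-*ₗ _ (Span⇒∈span {G ∖ i} Ai∈)) (Span⇒∈span {G ∖ i} (α , ≈ᴹ-refl))))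

    Redundant : Subset n → Set (c ⊔ ℓv)
    Redundant G = ∃ λ i → i ∈ G × Span R V A (G ∖ i) (A i)

    irredundant⇒MI : ∀ {G} → ¬ Redundant G → ModularIndependent R V A m G
    irredundant⇒MI {G} irredundant α αG≈0 i i∈G with ∈m⊎unit maximal chain (α i)
    ... | inj₁ αi∈m        = αi∈m
    ... | inj₂ (u , uαi≈1) = ⊥-elim (irredundant (i , i∈G , ∈span⇒Span {G ∖ i}
      (∈span-resp Ai≈ (∈span-*ₗ u (∈span-‿ (Span⇒∈span {G ∖ i} (α , ≈ᴹ-refl)))))))
      where
      Ai≈ : A i ≈ᴹ u *ₗ -ᴹ combo R V A (G ∖ i) α
      Ai≈ = begin
        A i                            ≈⟨ *ₗ-identityˡ (A i) ⟨
        1# *ₗ A i                      ≈⟨ *ₗ-congʳ uαi≈1 ⟨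
        (u * α i) *ₗ A i               ≈⟨ *ₗ-assoc u (α i) (A i) ⟩
        u *ₗ (α i *ₗ A i)              ≈⟨ *ₗ-congˡ (inverseˡ-uniqueᴹ _ _
                                            (≈ᴹ-trans (≈ᴹ-sym (combo-∖ A α i∈G)) αG≈0)) ⟩
        u *ₗ -ᴹ combo R V A (G ∖ i) α  ∎

    -- Redundancy is undecidable, so discarding redundant generators only shows that a
    -- basis cannot fail to exist.
    ¬¬∃-basis : ∀ Z → ¬ ¬ ∃ (IsBasis Z)
    ¬¬∃-basis Z = <-rec P shrink ∣ Z ∣ Z ≡.refl (λ z∈Z → z∈Z) (Generates-refl Z)
      where
      P : ℕ → Set (c ⊔ ℓ ⊔ ℓv)
      P k = ∀ G → ∣ G ∣ ≡ k → G ⊆ Z → Generates Z G → ¬ ¬ ∃ (IsBasis Z)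
      shrink : ∀ k → (∀ {k′} → k′ < k → P k′) → P k
      shrink _ rec G ≡.refl G⊆Z generates ¬basis = ¬¬-excluded-middle λ where
        (no irredundant)      → ¬basis (G , G⊆Z , generates , irredundant⇒MI irredundant)
        (yes (i , i∈G , Ai∈)) → rec (x∈p⇒∣p∖x∣<∣p∣ i∈G) (G ∖ i) ≡.refl
                                    (G⊆Z ∘ p∖x⊆p) (Span-∖-redundant i∈G Ai∈ ∘ generates) ¬basis

    ∈m-span⇒IdealSpan : ∀ {Z G w} → G ⊆ Z → w ∈m-span (A ∘ elements G) → IdealSpan R V A m Z w
    ∈m-span⇒IdealSpan {Z} {G} G⊆Z (κ , κ∈m , w≈κG) =
      ∣ G ∣ , κ , A ∘ elements G , κ∈m , (λ k → Generates-refl Z (G⊆Z (elements-∈ G k))) ,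
      ≈ᴹ-trans w≈κG (≈ᴹ-reflexive (≡.sym (sumM≡sum λ k → κ k *ₗ A (elements G k))))

    IdealSpan⇒∈m-span : ∀ {Z G w} → Generates Z G → IdealSpan R V A m Z w → w ∈m-span (A ∘ elements G)
    IdealSpan⇒∈m-span {Z} {G} generates (k , a , w , a∈m , w∈VZ , v≈aw) =
      ∈m-span-resp (≈ᴹ-trans v≈aw (≈ᴹ-reflexive (sumM≡sum λ j → a j *ₗ w j)))
                   (lincomb-∈m-span a∈m λ j → Span⇒∈span {G} (Span-generated {Z} {G} generates (w∈VZ j)))

    ∣independent∣≤∣generating∣ : ∀ {Z I G} → I ⊆ Z → ModularIndependent R V A m I → Generates Z G →
                                 ∣ I ∣ ≤ ∣ G ∣
    ∣independent∣≤∣generating∣ {I = I} {G} I⊆Z independent generates =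
      independent⇒length≤ (MI⇒Independent independent)
                          (λ k → Generates⇒∈span {G = G} generates (I⊆Z (elements-∈ I k)))

    basis-submodular : ∀ {X Y J GX GY B} → IntersectionCondition R V A m →
                       J ⊆ X ∪ Y → ModularIndependent R V A m J →
                       IsBasis X GX → IsBasis Y GY → IsBasis (X ∩ Y) B →
                       ∣ J ∣ +ℕ ∣ B ∣ ≤ ∣ GX ∣ +ℕ ∣ GY ∣
    basis-submodular {X} {Y} {J} {GX} {GY} {B} condition J⊆X∪Y J-independent
                     (GX⊆X , GX-generates , _) (GY⊆Y , GY-generates , _) (B⊆X∩Y , B-generates , B-independent) =
      length-submodular (MI⇒Independent J-independent) (MI⇒Independent B-independent)
                        uJ∈ uB∈X uB∈Y intersection
      where
      uJ∈ : ∀ j → A (elements J j) ∈span (A ∘ elements GX) ++ (A ∘ elements GY)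
      uJ∈ j with x∈p∪q⁻ X Y (J⊆X∪Y (elements-∈ J j))
      ... | inj₁ ∈X = ∈span-++ˡ (Generates⇒∈span {G = GX} GX-generates ∈X)
      ... | inj₂ ∈Y = ∈span-++ʳ (Generates⇒∈span {G = GY} GY-generates ∈Y)

      uB∈X : ∀ k → A (elements B k) ∈span (A ∘ elements GX)
      uB∈X k = Generates⇒∈span {G = GX} GX-generates (proj₁ (x∈p∩q⁻ X Y (B⊆X∩Y (elements-∈ B k))))

      uB∈Y : ∀ k → A (elements B k) ∈span (A ∘ elements GY)
      uB∈Y k = Generates⇒∈span {G = GY} GY-generates (proj₂ (x∈p∩q⁻ X Y (B⊆X∩Y (elements-∈ B k))))

      intersection : ∀ {w} → w ∈span (A ∘ elements B) →
                     w ∈m-span (A ∘ elements GX) → w ∈m-span (A ∘ elements GY) → w ∈m-span (A ∘ elements B)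
      intersection {w} w∈VB w∈mVX w∈mVY = IdealSpan⇒∈m-span {G = B} B-generates (proj₁ (condition X Y w)
        ( Span-generated {B} {X ∩ Y} (Generates-refl (X ∩ Y) ∘ B⊆X∩Y) (∈span⇒Span {B} w∈VB)
        , ∈m-span⇒IdealSpan {G = GX} GX⊆X w∈mVX
        , ∈m-span⇒IdealSpan {G = GY} GY⊆Y w∈mVY))

corollary3p11 : {c ℓ mv ℓv : Level} (R : CommutativeRing c ℓ) (m : RPred R) →
    IsChainRing R → IsMaximalIdeal R m → PowersIntersectTrivially R m →
    (V : Module R mv ℓv) (n : ℕ) (A : Fin n → Module.Carrierᴹ V) →
    IntersectionCondition R V A m →
    RankSubmodular R V A m
corollary3p11 R m chain maximal _ V n A condition X Y a b p q
              ((J , J⊆X∪Y , J-independent , ∣J∣≡a) , _) ((I , I⊆X∩Y , I-independent , ∣I∣≡b) , _)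
              (_ , X-bound) (_ , Y-bound) =
  decidable-stable (a +ℕ b ≤? p +ℕ q) λ a+b≰p+q →
    ¬¬∃-basis A X       λ (GX , GX-basis@(GX⊆X , _ , GX-independent)) →
    ¬¬∃-basis A Y       λ (GY , GY-basis@(GY⊆Y , _ , GY-independent)) →
    ¬¬∃-basis A (X ∩ Y) λ (B  , B-basis@(_ , B-generates , _)) →
    a+b≰p+q (begin
      a +ℕ b
        ≡⟨ ≡.cong₂ _+ℕ_ ∣J∣≡a ∣I∣≡b ⟨
      ∣ J ∣ +ℕ ∣ I ∣
        ≤⟨ +-monoʳ-≤ ∣ J ∣ (∣independent∣≤∣generating∣ A {G = B} I⊆X∩Y I-independent B-generates) ⟩
      ∣ J ∣ +ℕ ∣ B ∣
        ≤⟨ basis-submodular A condition J⊆X∪Y J-independent GX-basis GY-basis B-basis ⟩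
      ∣ GX ∣ +ℕ ∣ GY ∣
        ≤⟨ +-mono-≤ (X-bound GX GX⊆X GX-independent) (Y-bound GY GY⊆Y GY-independent) ⟩
      p +ℕ q
        ∎)
  where
  open Subsets chain maximal V
  open ≤-Reasoning
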